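{- Let $d>1$ and $k$ be integers and let $T$ be a digraph. If $T$ contains a $(dk,d)$-short jungle, then every digraph $S$ with $|S|\le k$ is topologically contained in $T$. If $T$ contains a $(dk,d)$-short immersion jungle, then every digraph $S$ with $|S|\le k$ can be immersed into $T$.
   Context: For a digraph $G$, $|G|=|V(G)|+|E(G)|$. For integers $k,d$, a $(k,d)$-short jungle (resp. short immersion jungle) in $T$ is a set $X\subseteq V(T)$ with $|X|\ge k$ such that for every two distinct $v,w\in X$ there are $k$ paths from $v$ to $w$, each of length at most $d$, which are pairwise vertex-disjoint apart from their endpoints (resp. pairwise arc-disjoint). $S$ is topologically contained in $T$ if there is a mapping sending vertices of $S$ injectively to vertices of $T$ and each arc $(u,v)$ of $S$ to a directed path in $T$ from the image of $u$ to the image of $v$, with these paths pairwise internally vertex-disjoint; $S$ can be immersed into $T$ if the same holds with the paths only required to be pairwise arc-disjoint. -}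

module Defs where

open import Data.Nat using (ℕ; zero; suc; _+_; _∸_; _≤_)
open import Data.Fin using (Fin)
open import Data.Fin.Subset as Sub using (Subset; ∣_∣)
open import Data.List using (List; []; _∷_; length; lookup)
open import Data.List.Membership.Propositional using (_∈_; _∉_)
open import Data.List.Relation.Unary.All using (All)
open import Data.List.Relation.Unary.Unique.Propositional using (Unique)
open import Data.List.Relation.Binary.Disjoint.Propositional using (Disjoint)
open import Data.Product using (Σ; _×_; _,_; proj₁; proj₂)
open import Relation.Binary.PropositionalEquality using (_≡_; _≢_)
open import Function.Definitions using (Injective)

record Digraph : Set where
  field
    n        : ℕ
    arcs     : List (Fin n × Fin n)
    loopless : All (λ a → proj₁ a ≢ proj₂ a) arcs
    simple   : Unique arcs
open Digraph public

size : Digraph → ℕ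
size G = n G + length (arcs G)

Arc : (G : Digraph) → Fin (n G) → Fin (n G) → Set
Arc G u v = (u , v) ∈ arcs G

data IsWalk (G : Digraph) : Fin (n G) → Fin (n G) → List (Fin (n G)) → Set where
  here : ∀ {u} → IsWalk G u u (u ∷ [])
  step : ∀ {u v w ps} → Arc G u v → IsWalk G v w ps → IsWalk G u w (u ∷ ps)

IsPath : (G : Digraph) → Fin (n G) → Fin (n G) → List (Fin (n G)) → Set
IsPath G u w ps = IsWalk G u w ps × Unique ps

-- length of a path = number of arcs
pathLength : ∀ {A : Set} → List A → ℕ
pathLength ps = length ps ∸ 1

dropLast : ∀ {A : Set} → List A → List A
dropLast [] = []
dropLast (x ∷ []) = []
dropLast (x ∷ y ∷ ys) = x ∷ dropLast (y ∷ ys)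

inner : ∀ {A : Set} → List A → List A
inner [] = []
inner (x ∷ xs) = dropLast xs

arcsOf : ∀ {A : Set} → List A → List (A × A)
arcsOf [] = []
arcsOf (x ∷ []) = []
arcsOf (x ∷ y ∷ ys) = (x , y) ∷ arcsOf (y ∷ ys)

ShortDisjointPaths : (G : Digraph) → ℕ → ℕ → Fin (n G) → Fin (n G) → Set
ShortDisjointPaths G k d v w =
  Σ (Fin k → List (Fin (n G))) λ P →
    (∀ i → IsPath G v w (P i) × pathLength (P i) ≤ d) ×
    (∀ i j → i ≢ j → (P i ≢ P j) × Disjoint (inner (P i)) (inner (P j)))

ShortArcDisjointPaths : (G : Digraph) → ℕ → ℕ → Fin (n G) → Fin (n G) → Set
ShortArcDisjointPaths G k d v w =
  Σ (Fin k → List (Fin (n G))) λ P →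
    (∀ i → IsPath G v w (P i) × pathLength (P i) ≤ d) ×
    (∀ i j → i ≢ j → Disjoint (arcsOf (P i)) (arcsOf (P j)))

ShortJungle : (T : Digraph) → ℕ → ℕ → Set
ShortJungle T k d =
  Σ (Subset (n T)) λ X → k ≤ ∣ X ∣ ×
    (∀ v w → v Sub.∈ X → w Sub.∈ X → v ≢ w → ShortDisjointPaths T k d v w)

ShortImmersionJungle : (T : Digraph) → ℕ → ℕ → Set
ShortImmersionJungle T k d =
  Σ (Subset (n T)) λ X → k ≤ ∣ X ∣ ×
    (∀ v w → v Sub.∈ X → w Sub.∈ X → v ≢ w → ShortArcDisjointPaths T k d v w)

tail' : (S : Digraph) → Fin (length (arcs S)) → Fin (n S)
tail' S e = proj₁ (lookup (arcs S) e)

head' : (S : Digraph) → Fin (length (arcs S)) → Fin (n S)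
head' S e = proj₂ (lookup (arcs S) e)

TopContained : Digraph → Digraph → Set
TopContained S T =
  Σ (Fin (n S) → Fin (n T)) λ f → Injective _≡_ _≡_ f ×
  Σ (Fin (length (arcs S)) → List (Fin (n T))) λ P →
    (∀ e → IsPath T (f (tail' S e)) (f (head' S e)) (P e)) ×
    (∀ e e' → e ≢ e' → Disjoint (inner (P e)) (inner (P e'))) ×
    (∀ e x → f x ∉ inner (P e))

Immersed : Digraph → Digraph → Set
Immersed S T =
  Σ (Fin (n S) → Fin (n T)) λ f → Injective _≡_ _≡_ f ×
  Σ (Fin (length (arcs S)) → List (Fin (n T))) λ P →
    (∀ e → IsPath T (f (tail' S e)) (f (head' S e)) (P e)) ×
    (∀ e e' → e ≢ e' → Disjoint (arcsOf (P e)) (arcsOf (P e')))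

module Submission where

-- Proof idea (greedy routing through a short jungle).
-- Let X be the jungle, N = d·k its path count and S a digraph with |S| ≤ k.
-- Map the vertices of S injectively into X; this is possible because
-- |V(S)| ≤ k ≤ d·k ≤ |X|.  Then route the arcs of S one after the other.
-- For an arc e, the jungle offers N short paths between the images of its
-- ends whose "footprints" are pairwise disjoint: the inner vertices in the
-- topological case, the arcs in the immersion case.  A footprint has at
-- most c elements (c = d - 1, resp. c = d).  If F lists everything the new
-- path must avoid (branch vertices resp. nothing, plus the footprints of
-- the paths already chosen), then |F| < N, so by the pigeonhole principle
-- one of the N offered paths misses F.  The budget |V(S)| + |E(S)|·c ≤ d·k
-- keeps this invariant until all arcs are routed.

open import Defs
open import Data.Nat using (ℕ; zero; suc; _*_; _+_; _∸_; _≤_; _<_; >-nonZero)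
open import Data.Nat.Properties
open import Data.Product using (_×_; _,_; proj₁; proj₂; Σ; ∃; ∃₂)
open import Data.Product.Properties using (≡-dec)
open import Data.Fin as Fin using (Fin; zero; suc; inject≤)
import Data.Fin.Properties as FinP
open import Data.Fin.Subset as Sub using (Subset; ∣_∣; inside; outside)
open import Data.Vec.Base using (_∷_; here; there)
open import Data.List using (List; []; _∷_; length; lookup; _++_; map; allFin)
open import Data.List.Properties using (length-++; length-map; length-tabulate)
open import Data.List.Membership.Propositional using (_∈_; _∉_)
open import Data.List.Membership.Propositional.Properties using (∈-map⁺; ∈-allFin; ∈-++⁺ˡ; ∈-++⁺ʳ; ∈-lookup)
import Data.List.Membership.DecPropositional as DecMembership
import Data.List.Relation.Unary.All as All
open import Data.List.Relation.Unary.Any as Any using (Any; any?; index)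
open import Data.List.Relation.Unary.Any.Properties using (lookup-index)
open import Data.List.Relation.Binary.Disjoint.Propositional using (Disjoint)
open import Relation.Binary.PropositionalEquality
open import Relation.Binary.Definitions using (DecidableEquality)
open import Relation.Nullary using (¬_; yes; no; ¬?)
open import Relation.Nullary.Decidable using (decidable-stable)
open import Data.Empty using (⊥-elim)
open import Function.Definitions using (Injective)

PairwiseDisjoint : ∀ {I A : Set} → (I → List A) → Set
PairwiseDisjoint X = ∀ i j → i ≢ j → Disjoint (X i) (X j)

module Selection {A : Set} (_≟_ : DecidableEquality A) where
  open DecMembership _≟_ using (_∈?_)

  -- Pigeonhole step: a list B with fewer than N entries meets fewer than N
  -- members of a pairwise disjoint family of N lists, so one member misses
  -- B entirely.  (Each member meeting B is sent to the position of a common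
  -- element; two members sharing a position would not be disjoint.)
  avoidingMember : ∀ {N} (X : Fin N → List A) → PairwiseDisjoint X →
    (B : List A) → length B < N → ∃ λ i → Disjoint B (X i)
  avoidingMember {N} X disjoint B B<N
    with FinP.any? (λ i → ¬? (any? (_∈? X i) B))
  ... | yes (i , B∩Xi=∅) =
    i , λ (b∈B , b∈Xi) → B∩Xi=∅ (Any.map (λ b≡x → subst (_∈ X i) b≡x b∈Xi) b∈B)
  ... | no noneAvoids = ⊥-elim (collision (FinP.pigeonhole B<N position))
    where
      meets : ∀ i → Any (_∈ X i) B
      meets i = decidable-stable (any? (_∈? X i) B) (λ m → noneAvoids (i , m))

      position : Fin N → Fin (length B)
      position i = index (meets i)

      collision : ¬ (∃₂ λ i j → i Fin.< j × position i ≡ position j)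
      collision (i , j , i<j , samePosition) =
        disjoint i j (λ i≡j → <-irrefl (cong Fin.toℕ i≡j) i<j)
          ( lookup-index (meets i)
          , subst (λ t → lookup B t ∈ X j) (sym samePosition) (lookup-index (meets j)))

  -- Choose for the first family by avoidingMember,
  -- then add the chosen list (at most c entries) to F and recurse on the
  -- remaining m - 1 families, whose budget is c smaller.
  greedyChoice : ∀ {N} c m (X : Fin m → Fin N → List A) →
    (∀ e → PairwiseDisjoint (X e)) → (∀ e i → length (X e i) ≤ c) → 0 < c →
    (F : List A) → length F + m * c ≤ N →
    Σ (Fin m → Fin N) λ σ →
      PairwiseDisjoint (λ e → X e (σ e)) × (∀ e → Disjoint F (X e (σ e)))
  greedyChoice c zero X _ _ _ F _ = (λ ()) , (λ ()) , (λ ())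
  greedyChoice {N} c (suc m) X disjoint small 0<c F budget = σ , chosenDisjoint , avoidsF
    where
      F<N : length F < N
      F<N = begin-strict
        length F                 <⟨ m<m+n (length F) (≤-trans 0<c (m≤m+n c (m * c))) ⟩
        length F + (c + m * c)   ≤⟨ budget ⟩
        N                        ∎
        where open ≤-Reasoning

      first : ∃ λ i → Disjoint F (X zero i)
      first = avoidingMember (X zero) (disjoint zero) F F<N

      F′ : List A
      F′ = X zero (proj₁ first) ++ F

      budget′ : length F′ + m * c ≤ N
      budget′ = begin
        length F′ + m * c                       ≡⟨ cong (_+ m * c) (length-++ (X zero (proj₁ first))) ⟩
        length (X zero (proj₁ first)) + length F + m * c
                                                ≤⟨ +-monoˡ-≤ (m * c) (+-monoˡ-≤ (length F) (small zero _)) ⟩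
        c + length F + m * c                    ≡⟨ cong (_+ m * c) (+-comm c (length F)) ⟩
        length F + c + m * c                    ≡⟨ +-assoc (length F) c (m * c) ⟩
        length F + (c + m * c)                  ≤⟨ budget ⟩
        N                                       ∎
        where open ≤-Reasoning

      rest : Σ (Fin m → Fin N) λ τ →
        PairwiseDisjoint (λ e → X (suc e) (τ e)) × (∀ e → Disjoint F′ (X (suc e) (τ e)))
      rest = greedyChoice c m (λ e → X (suc e)) (λ e → disjoint (suc e)) (λ e → small (suc e)) 0<c F′ budget′

      σ : Fin (suc m) → Fin N
      σ zero = proj₁ first
      σ (suc e) = proj₁ rest e

      restAvoidsF′ : ∀ e → Disjoint F′ (X (suc e) (σ (suc e)))
      restAvoidsF′ = proj₂ (proj₂ rest)

      chosenDisjoint : PairwiseDisjoint (λ e → X e (σ e))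
      chosenDisjoint zero zero 0≢0 = ⊥-elim (0≢0 refl)
      chosenDisjoint zero (suc e′) _ (x , y) = restAvoidsF′ e′ (∈-++⁺ˡ x , y)
      chosenDisjoint (suc e) zero _ (x , y) = restAvoidsF′ e (∈-++⁺ˡ y , x)
      chosenDisjoint (suc e) (suc e′) e≢e′ = proj₁ (proj₂ rest) e e′ (λ eq → e≢e′ (cong suc eq))

      avoidsF : ∀ e → Disjoint F (X e (σ e))
      avoidsF zero = proj₂ first
      avoidsF (suc e) (x , y) = restAvoidsF′ e (∈-++⁺ʳ _ x , y)

open Selection using (greedyChoice)

enumerate : ∀ {m} (p : Subset m) → Fin ∣ p ∣ → Fin m
enumerate (inside ∷ p) zero = zero
enumerate (inside ∷ p) (suc i) = suc (enumerate p i)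
enumerate (outside ∷ p) i = suc (enumerate p i)

enumerate-∈ : ∀ {m} (p : Subset m) (i : Fin ∣ p ∣) → enumerate p i Sub.∈ p
enumerate-∈ (inside ∷ p) zero = here
enumerate-∈ (inside ∷ p) (suc i) = there (enumerate-∈ p i)
enumerate-∈ (outside ∷ p) i = there (enumerate-∈ p i)

enumerate-injective : ∀ {m} (p : Subset m) → Injective _≡_ _≡_ (enumerate p)
enumerate-injective (inside ∷ p) {zero} {zero} _ = refl
enumerate-injective (inside ∷ p) {suc i} {suc j} eq = cong suc (enumerate-injective p (FinP.suc-injective eq))
enumerate-injective (outside ∷ p) eq = enumerate-injective p (FinP.suc-injective eq)

injectInto : ∀ {m l} (p : Subset m) → l ≤ ∣ p ∣ →
  Σ (Fin l → Fin m) λ f → Injective _≡_ _≡_ f × (∀ x → f x Sub.∈ p)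
injectInto p l≤∣p∣ =
    (λ x → enumerate p (inject≤ x l≤∣p∣))
  , (λ eq → FinP.inject≤-injective l≤∣p∣ l≤∣p∣ _ _ (enumerate-injective p eq))
  , (λ x → enumerate-∈ p (inject≤ x l≤∣p∣))

length-dropLast : ∀ {A : Set} (xs : List A) → length (dropLast xs) ≡ length xs ∸ 1
length-dropLast [] = refl
length-dropLast (x ∷ []) = refl
length-dropLast (x ∷ y ∷ ys) = cong suc (length-dropLast (y ∷ ys))

length-inner : ∀ {A : Set} (ps : List A) → length (inner ps) ≡ pathLength ps ∸ 1
length-inner [] = refl
length-inner (x ∷ xs) = length-dropLast xs

length-arcsOf : ∀ {A : Set} (ps : List A) → length (arcsOf ps) ≡ pathLength ps
length-arcsOf [] = refl
length-arcsOf (x ∷ []) = refl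
length-arcsOf (x ∷ y ∷ ys) = cong suc (length-arcsOf (y ∷ ys))

branchVertices : ∀ {d k} → 0 < d → (S T : Digraph) (X : Subset (n T)) →
  size S ≤ k → d * k ≤ ∣ X ∣ →
  Σ (Fin (n S) → Fin (n T)) λ f → Injective _≡_ _≡_ f × (∀ x → f x Sub.∈ X)
branchVertices {d} {k} 0<d S T X |S|≤k dk≤∣X∣ = injectInto X (begin
    n S         ≤⟨ m≤m+n (n S) (length (arcs S)) ⟩
    size S      ≤⟨ |S|≤k ⟩
    k           ≤⟨ m≤n*m k d {{>-nonZero 0<d}} ⟩
    d * k       ≤⟨ dk≤∣X∣ ⟩
    ∣ X ∣       ∎)
  where open ≤-Reasoning

-- S is loopless, so an injective vertex map separates the ends of every arc.
arcEndsDistinct : ∀ (S : Digraph) {V : Set} (f : Fin (n S) → V) → Injective _≡_ _≡_ f →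
  ∀ e → f (tail' S e) ≢ f (head' S e)
arcEndsDistinct S f f-inj e eq = All.lookup (loopless S) (∈-lookup e) (f-inj eq)

-- Budgets: with a branch vertices and b arcs, a + b ≤ k, the forbidden
-- material never exceeds the d·k paths offered by the jungle.
topologicalBudget : ∀ {a b k d} → a + b ≤ k → 0 < d → a + b * (d ∸ 1) ≤ d * k
topologicalBudget {a} {b} {k} {d} a+b≤k 0<d = begin
  a + b * (d ∸ 1)   ≤⟨ +-mono-≤ (m≤m*n a d {{>-nonZero 0<d}}) (*-monoʳ-≤ b (m∸n≤m d 1)) ⟩
  a * d + b * d     ≡⟨ *-distribʳ-+ d a b ⟨
  (a + b) * d       ≤⟨ *-monoˡ-≤ d a+b≤k ⟩
  k * d             ≡⟨ *-comm k d ⟩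
  d * k             ∎
  where open ≤-Reasoning

immersionBudget : ∀ {a b k d} → a + b ≤ k → b * d ≤ d * k
immersionBudget {a} {b} {k} {d} a+b≤k = begin
  b * d   ≤⟨ *-monoˡ-≤ d (≤-trans (m≤n+m b a) a+b≤k) ⟩
  k * d   ≡⟨ *-comm k d ⟩
  d * k   ∎
  where open ≤-Reasoning

-- Footprints are inner vertices (at most d - 1 per
-- path) and the branch vertices are forbidden from the start.
jungle⇒topContained : ∀ {d k} → 1 < d → (T S : Digraph) →
  ShortJungle T (d * k) d → size S ≤ k → TopContained S T
jungle⇒topContained {d} {k} 1<d T S (X , dk≤∣X∣ , jungle) |S|≤k =
  f , f-inj , P , (λ e → proj₁ (short e (σ e))) , proj₁ (proj₂ choice) , avoidsBranch
  where
    branch : Σ (Fin (n S) → Fin (n T)) λ f → Injective _≡_ _≡_ f × (∀ x → f x Sub.∈ X)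
    branch = branchVertices (<⇒≤ 1<d) S T X |S|≤k dk≤∣X∣

    f : Fin (n S) → Fin (n T)
    f = proj₁ branch

    f-inj : Injective _≡_ _≡_ f
    f-inj = proj₁ (proj₂ branch)

    offered : ∀ e → ShortDisjointPaths T (d * k) d (f (tail' S e)) (f (head' S e))
    offered e = jungle _ _ (proj₂ (proj₂ branch) _) (proj₂ (proj₂ branch) _) (arcEndsDistinct S f f-inj e)

    short : ∀ e i → IsPath T (f (tail' S e)) (f (head' S e)) (proj₁ (offered e) i) ×
                    pathLength (proj₁ (offered e) i) ≤ d
    short e = proj₁ (proj₂ (offered e))

    F : List (Fin (n T))
    F = map f (allFin (n S))

    |F|≡n : length F ≡ n S
    |F|≡n = trans (length-map f (allFin (n S))) (length-tabulate (λ x → x))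

    choice : Σ (Fin (length (arcs S)) → Fin (d * k)) λ σ →
      PairwiseDisjoint (λ e → inner (proj₁ (offered e) (σ e))) ×
      (∀ e → Disjoint F (inner (proj₁ (offered e) (σ e))))
    choice = greedyChoice FinP._≟_ (d ∸ 1) (length (arcs S))
      (λ e i → inner (proj₁ (offered e) i))
      (λ e i j i≢j → proj₂ (proj₂ (proj₂ (offered e)) i j i≢j))
      (λ e i → ≤-trans (≤-reflexive (length-inner (proj₁ (offered e) i))) (∸-monoˡ-≤ 1 (proj₂ (short e i))))
      (m<n⇒0<n∸m 1<d) F
      (subst (λ a → a + length (arcs S) * (d ∸ 1) ≤ d * k) (sym |F|≡n) (topologicalBudget {n S} |S|≤k (<⇒≤ 1<d)))

    σ : Fin (length (arcs S)) → Fin (d * k)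
    σ = proj₁ choice

    P : Fin (length (arcs S)) → List (Fin (n T))
    P e = proj₁ (offered e) (σ e)

    avoidsBranch : ∀ e x → f x ∉ inner (P e)
    avoidsBranch e x fx∈P = proj₂ (proj₂ choice) e (∈-map⁺ f (∈-allFin x) , fx∈P)

-- Second half: a (d·k, d)-short immersion jungle (d > 0) immerses every
-- digraph S with |S| ≤ k.  Footprints are arcs (at most d per path) and
-- nothing is forbidden initially.
jungle⇒immersed : ∀ {d k} → 0 < d → (T S : Digraph) →
  ShortImmersionJungle T (d * k) d → size S ≤ k → Immersed S T
jungle⇒immersed {d} {k} 0<d T S (X , dk≤∣X∣ , jungle) |S|≤k =
  f , f-inj , P , (λ e → proj₁ (short e (σ e))) , proj₁ (proj₂ choice)
  where
    branch : Σ (Fin (n S) → Fin (n T)) λ f → Injective _≡_ _≡_ f × (∀ x → f x Sub.∈ X)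
    branch = branchVertices 0<d S T X |S|≤k dk≤∣X∣

    f : Fin (n S) → Fin (n T)
    f = proj₁ branch

    f-inj : Injective _≡_ _≡_ f
    f-inj = proj₁ (proj₂ branch)

    offered : ∀ e → ShortArcDisjointPaths T (d * k) d (f (tail' S e)) (f (head' S e))
    offered e = jungle _ _ (proj₂ (proj₂ branch) _) (proj₂ (proj₂ branch) _) (arcEndsDistinct S f f-inj e)

    short : ∀ e i → IsPath T (f (tail' S e)) (f (head' S e)) (proj₁ (offered e) i) ×
                    pathLength (proj₁ (offered e) i) ≤ d
    short e = proj₁ (proj₂ (offered e))

    choice : Σ (Fin (length (arcs S)) → Fin (d * k)) λ σ →
      PairwiseDisjoint (λ e → arcsOf (proj₁ (offered e) (σ e))) ×
      (∀ e → Disjoint [] (arcsOf (proj₁ (offered e) (σ e))))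
    choice = greedyChoice (≡-dec FinP._≟_ FinP._≟_) d (length (arcs S))
      (λ e i → arcsOf (proj₁ (offered e) i))
      (λ e → proj₂ (proj₂ (offered e)))
      (λ e i → ≤-trans (≤-reflexive (length-arcsOf (proj₁ (offered e) i))) (proj₂ (short e i)))
      0<d [] (immersionBudget {n S} |S|≤k)

    σ : Fin (length (arcs S)) → Fin (d * k)
    σ = proj₁ choice

    P : Fin (length (arcs S)) → List (Fin (n T))
    P e = proj₁ (offered e) (σ e)

lemma8 : (d k : ℕ) → 1 < d → (T : Digraph) →
    (ShortJungle T (d * k) d → (S : Digraph) → size S ≤ k → TopContained S T) ×
    (ShortImmersionJungle T (d * k) d → (S : Digraph) → size S ≤ k → Immersed S T)
lemma8 d k 1<d T =
    (λ jungle S |S|≤k → jungle⇒topContained 1<d T S jungle |S|≤k)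
  , (λ jungle S |S|≤k → jungle⇒immersed (<⇒≤ 1<d) T S jungle |S|≤k)
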